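{- For $d\ge 0$, let $m_d$ be the number of combinators of degree $d$ that are maximal elements of the poset $\mathcal{P}$ of the Mockingbird CLS. Then the generating series $F_{\max}(\mathsf{z}) = \sum_{d\ge 0} m_d\,\mathsf{z}^d$ satisfies $F_{\max} = 1 + \mathsf{z} + \mathsf{z}F_{\max}^2 - \mathsf{z}F_{\max}$.
   Context: Terms over $\{{\rm M}\}$ are the smallest set containing the variables $\mathsf{x}_1,\mathsf{x}_2,\dots$, the symbol ${\rm M}$, and $(\mathfrak{t}_1\mathfrak{t}_2)$ for terms $\mathfrak{t}_1,\mathfrak{t}_2$ (binary trees with leaves labeled by variables or ${\rm M}$); a combinator is a term with no variables, and its degree is its number of internal (application) nodes. The rewrite relation $\Rightarrow$ is the smallest relation with ${\rm M}\,\mathfrak{s}\Rightarrow\mathfrak{s}\,\mathfrak{s}$ for every term $\mathfrak{s}$, closed under $\mathfrak{t}_1\Rightarrow\mathfrak{t}_1'$ implies $\mathfrak{t}_1\mathfrak{t}_2\Rightarrow\mathfrak{t}_1'\mathfrak{t}_2$ and $\mathfrak{t}_2\mathfrak{t}_1\Rightarrow\mathfrak{t}_2\mathfrak{t}_1'$; its reflexive-transitive closure $\preccurlyeq$ is a partial order, and $\mathcal{P}$ is the poset of all terms under $\preccurlyeq$. -}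

module Defs where

open import Data.Nat using (ℕ; zero; suc; _∸_)
import Data.Nat as ℕ
open import Data.Integer using (ℤ; +_; _+_; _*_; _-_)
open import Data.Product using (_×_)
open import Data.List using (List)
open import Relation.Binary.PropositionalEquality using (_≡_)
open import Relation.Binary.Construct.Closure.ReflexiveTransitive using (Star)

data Term : Set where
  var : ℕ → Term
  M   : Term
  _·_ : Term → Term → Term

infixl 9 _·_

data _⇒_ : Term → Term → Set where
  ⇒M : ∀ {s} → (M · s) ⇒ (s · s)
  ⇒l : ∀ {t₁ t₁′ t₂} → t₁ ⇒ t₁′ → (t₁ · t₂) ⇒ (t₁′ · t₂)
  ⇒r : ∀ {t₁ t₂ t₂′} → t₂ ⇒ t₂′ → (t₁ · t₂) ⇒ (t₁ · t₂′)

_≼_ : Term → Term → Set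
_≼_ = Star _⇒_

data IsCombinator : Term → Set where
  M-comb : IsCombinator M
  ·-comb : ∀ {t₁ t₂} → IsCombinator t₁ → IsCombinator t₂ → IsCombinator (t₁ · t₂)

degree : Term → ℕ
degree (var _)   = 0
degree M         = 0
degree (t₁ · t₂) = suc (degree t₁ ℕ.+ degree t₂)

IsMaximal : Term → Set
IsMaximal t = ∀ s → t ≼ s → s ≡ t

MaxComb : ℕ → Term → Set
MaxComb d t = IsCombinator t × degree t ≡ d × IsMaximal t

Series : Set
Series = ℕ → ℤ

_≈ₛ_ : Series → Series → Set
F ≈ₛ G = ∀ n → F n ≡ G n

1ₛ : Series
1ₛ zero    = + 1
1ₛ (suc _) = + 0

zₛ : Series
zₛ 1 = + 1
zₛ _ = + 0

_+ₛ_ : Series → Series → Series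
(F +ₛ G) n = F n + G n

_-ₛ_ : Series → Series → Series
(F -ₛ G) n = F n - G n

sumUpTo : ℕ → (ℕ → ℤ) → ℤ
sumUpTo zero    f = f 0
sumUpTo (suc n) f = sumUpTo n f + f (suc n)

_*ₛ_ : Series → Series → Series
(F *ₛ G) n = sumUpTo n (λ i → F i * G (n ∸ i))

infixl 6 _+ₛ_ _-ₛ_
infixl 7 _*ₛ_
infix 4 _≈ₛ_

-- A combinator is maximal exactly when it admits no step other than M M ⇒ M M, i.e. when it is
-- M, M M, or x y with x a maximal application and y maximal.  Writing F for the series of maximal
-- combinators, F − 1 counts the maximal applications, and the decomposition reads
-- F − 1 = z + z (F − 1) F.
module Submission where

open import Defs
open import Data.Nat using (ℕ; zero; suc; _∸_; _≤_; _<_; z≤n; s≤s)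
import Data.Nat as ℕ
import Data.Nat.Properties as ℕ
open import Data.Integer using (ℤ; +_; _+_; _*_; _-_)
import Data.Integer.Properties as ℤ
open import Data.Integer.Tactic.RingSolver using (solve-∀)
open import Data.Product using (Σ; ∃-syntax; _×_; _,_; proj₂)
open import Data.Sum using (inj₁; inj₂)
open import Data.List using (List; []; _∷_; _++_; length; cartesianProductWith; map)
import Data.List.Properties as List
open import Data.List.Membership.Propositional using (_∈_)
open import Data.List.Membership.Propositional.Properties
  using (∈-++⁺ˡ; ∈-++⁺ʳ; ∈-++⁻; ∈-cartesianProductWith⁺; ∈-cartesianProductWith⁻)
open import Data.List.Relation.Unary.Any using (here)
open import Data.List.Relation.Unary.All using ([])
open import Data.List.Relation.Unary.AllPairs using ([]; _∷_)
open import Data.List.Relation.Unary.Unique.Propositional using (Unique)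
import Data.List.Relation.Unary.Unique.Propositional.Properties as Unique
open import Function.Bundles using (_⇔_; mk⇔; Equivalence)
open import Relation.Binary.PropositionalEquality
  using (_≡_; refl; sym; trans; cong; cong₂; subst; module ≡-Reasoning)
open import Relation.Binary.Construct.Closure.ReflexiveTransitive using (ε; _◅_; gmap)
open import Relation.Nullary using (¬_; yes; no)

data Stable : Term → Set where
  M   : Stable M
  MM  : Stable (M · M)
  _·_ : ∀ {a b c} → Stable (a · b) → Stable c → Stable (a · b · c)

Stable⇒IsCombinator : ∀ {t} → Stable t → IsCombinator t
Stable⇒IsCombinator M       = M-comb
Stable⇒IsCombinator MM      = ·-comb M-comb M-comb
Stable⇒IsCombinator (s · u) = ·-comb (Stable⇒IsCombinator s) (Stable⇒IsCombinator u)

Stable⇒fixed : ∀ {t s} → Stable t → t ⇒ s → s ≡ t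
Stable⇒fixed MM      ⇒M       = refl
Stable⇒fixed (s · u) (⇒l t⇒s) = cong (_· _) (Stable⇒fixed s t⇒s)
Stable⇒fixed (s · u) (⇒r t⇒s) = cong (_ ·_) (Stable⇒fixed u t⇒s)

Stable⇒IsMaximal : ∀ {t} → Stable t → IsMaximal t
Stable⇒IsMaximal st s ε = refl
Stable⇒IsMaximal st s (t⇒u ◅ u≼s) with refl ← Stable⇒fixed st t⇒u = Stable⇒IsMaximal st s u≼s

IsMaximal-·ˡ : ∀ {a b} → IsMaximal (a · b) → IsMaximal a
IsMaximal-·ˡ {b = b} max s a≼s = cong left (max (s · b) (gmap (_· b) ⇒l a≼s))
  where
  left : Term → Term
  left (x · _) = x
  left x       = x

IsMaximal-·ʳ : ∀ {a b} → IsMaximal (a · b) → IsMaximal b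
IsMaximal-·ʳ {a = a} max s b≼s = cong right (max (a · s) (gmap (a ·_) ⇒r b≼s))
  where
  right : Term → Term
  right (_ · y) = y
  right y       = y

IsMaximal⇒Stable : ∀ {t} → IsCombinator t → IsMaximal t → Stable t
IsMaximal⇒Stable M-comb                            _   = M
IsMaximal⇒Stable (·-comb M-comb M-comb)            _   = MM
IsMaximal⇒Stable (·-comb M-comb (·-comb _ _))      max with () ← max _ (⇒M ◅ ε)
IsMaximal⇒Stable (·-comb ab@(·-comb _ _) c) max =
  IsMaximal⇒Stable ab (IsMaximal-·ˡ max) · IsMaximal⇒Stable c (IsMaximal-·ʳ max)

MaxComb⇔Stable : ∀ d t → MaxComb d t ⇔ (Stable t × degree t ≡ d)
MaxComb⇔Stable d t = mk⇔
  (λ (comb , deg , max) → IsMaximal⇒Stable comb max , deg)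
  (λ (st , deg) → Stable⇒IsCombinator st , deg , Stable⇒IsMaximal st)

Stable-· : ∀ {x y} → Stable x → 0 < degree x → Stable y → Stable (x · y)
Stable-· MM      _ sy = MM · sy
Stable-· (s · u) _ sy = (s · u) · sy

products : List Term → List Term → List Term
products = cartesianProductWith _·_

length-products : ∀ xs ys → length (products xs ys) ≡ length xs ℕ.* length ys
length-products []       ys = refl
length-products (x ∷ xs) ys = begin
  length (map (x ·_) ys ++ products xs ys)
    ≡⟨ List.length-++ (map (x ·_) ys) ⟩
  length (map (x ·_) ys) ℕ.+ length (products xs ys)
    ≡⟨ cong₂ ℕ._+_ (List.length-map (x ·_) ys) (length-products xs ys) ⟩
  length ys ℕ.+ length xs ℕ.* length ys
    ∎
  where open ≡-Reasoning

·-injective : ∀ {w x y z : Term} → w · y ≡ x · z → w ≡ x × y ≡ z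
·-injective refl = refl , refl

+length-products : ∀ xs ys → + length (products xs ys) ≡ + length xs * + length ys
+length-products xs ys = trans (cong +_ (length-products xs ys)) (ℤ.pos-* (length xs) (length ys))

productsUpTo : (ℕ → List Term) → (ℕ → List Term) → ℕ → ℕ → List Term
productsUpTo A B n zero    = products (A 0) (B n)
productsUpTo A B n (suc k) = productsUpTo A B n k ++ products (A (suc k)) (B (n ∸ suc k))

module _ {A B : ℕ → List Term} {n : ℕ} where

  ∈-productsUpTo⁺ : ∀ {i k x y} → i ≤ k → x ∈ A i → y ∈ B (n ∸ i) → x · y ∈ productsUpTo A B n k
  ∈-productsUpTo⁺ {k = zero}  z≤n x∈ y∈ = ∈-cartesianProductWith⁺ _·_ x∈ y∈
  ∈-productsUpTo⁺ {i} {suc k} i≤k x∈ y∈ with i ℕ.≟ suc k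
  ... | yes refl = ∈-++⁺ʳ (productsUpTo A B n k) (∈-cartesianProductWith⁺ _·_ x∈ y∈)
  ... | no i≢k   = ∈-++⁺ˡ (∈-productsUpTo⁺ (ℕ.≤-pred (ℕ.≤∧≢⇒< i≤k i≢k)) x∈ y∈)

  ∈-productsUpTo⁻ : ∀ k {t} → t ∈ productsUpTo A B n k →
                    ∃[ i ] ∃[ x ] ∃[ y ] i ≤ k × x ∈ A i × y ∈ B (n ∸ i) × t ≡ x · y
  ∈-productsUpTo⁻ zero t∈ with x , y , x∈ , y∈ , t≡ ← ∈-cartesianProductWith⁻ _·_ (A 0) (B n) t∈ =
    0 , x , y , z≤n , x∈ , y∈ , t≡
  ∈-productsUpTo⁻ (suc k) t∈ with ∈-++⁻ (productsUpTo A B n k) t∈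
  ... | inj₁ t∈′ with i , x , y , i≤k , rest ← ∈-productsUpTo⁻ k t∈′ =
    i , x , y , ℕ.m≤n⇒m≤1+n i≤k , rest
  ... | inj₂ t∈′
    with x , y , x∈ , y∈ , t≡ ← ∈-cartesianProductWith⁻ _·_ (A (suc k)) (B (n ∸ suc k)) t∈′ =
    suc k , x , y , ℕ.≤-refl , x∈ , y∈ , t≡

  productsUpTo-unique : (∀ i → Unique (A i)) → (∀ j → Unique (B j)) →
                        (∀ {i x} → x ∈ A i → degree x ≡ i) → ∀ k → Unique (productsUpTo A B n k)
  productsUpTo-unique uA uB deg zero    = Unique.cartesianProductWith⁺ _·_ ·-injective (uA 0) (uB n)
  productsUpTo-unique uA uB deg (suc k) =
    Unique.++⁺ (productsUpTo-unique uA uB deg k)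
               (Unique.cartesianProductWith⁺ _·_ ·-injective (uA (suc k)) (uB (n ∸ suc k)))
               disjoint
    where
    disjoint : ∀ {t} → ¬ (t ∈ productsUpTo A B n k × t ∈ products (A (suc k)) (B (n ∸ suc k)))
    disjoint (t∈ , t∈′)
      with i , x , y , i≤k , x∈ , _ , refl ← ∈-productsUpTo⁻ k t∈
         | x′ , y′ , x′∈ , _ , eq ← ∈-cartesianProductWith⁻ _·_ (A (suc k)) (B (n ∸ suc k)) t∈′
      with refl , refl ← ·-injective eq
      = ℕ.<-irrefl (trans (sym (deg x∈)) (deg x′∈)) (s≤s i≤k)

  length-productsUpTo : ∀ k → + length (productsUpTo A B n k) ≡
                              sumUpTo k (λ i → + length (A i) * + length (B (n ∸ i)))
  length-productsUpTo zero    = +length-products (A 0) (B n)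
  length-productsUpTo (suc k) = begin
    + length (productsUpTo A B n k ++ Q)
      ≡⟨ cong +_ (List.length-++ (productsUpTo A B n k)) ⟩
    + (length (productsUpTo A B n k) ℕ.+ length Q)
      ≡⟨ ℤ.pos-+ _ (length Q) ⟩
    + length (productsUpTo A B n k) + + length Q
      ≡⟨ cong₂ _+_ (length-productsUpTo k) (+length-products (A (suc k)) _) ⟩
    sumUpTo (suc k) (λ i → + length (A i) * + length (B (n ∸ i)))
      ∎
    where
    open ≡-Reasoning
    Q : List Term
    Q = products (A (suc k)) (B (n ∸ suc k))

productsUpTo-cong : ∀ {A A′ B B′ : ℕ → List Term} n k →
                    (∀ i → i ≤ k → A i ≡ A′ i) → (∀ j → j ≤ n → B j ≡ B′ j) →
                    productsUpTo A B n k ≡ productsUpTo A′ B′ n k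
productsUpTo-cong n zero    A≗A′ B≗B′ = cong₂ products (A≗A′ 0 z≤n) (B≗B′ n ℕ.≤-refl)
productsUpTo-cong n (suc k) A≗A′ B≗B′ =
  cong₂ _++_ (productsUpTo-cong n k (λ i i≤k → A≗A′ i (ℕ.m≤n⇒m≤1+n i≤k)) B≗B′)
             (cong₂ products (A≗A′ (suc k) ℕ.≤-refl) (B≗B′ (n ∸ suc k) (ℕ.m∸n≤m n (suc k))))

positive : (ℕ → List Term) → ℕ → List Term
positive A zero    = []
positive A (suc i) = A (suc i)

∈-positive⁻ : ∀ {A x} i → x ∈ positive A i → 0 < i × x ∈ A i
∈-positive⁻ (suc i) x∈ = s≤s z≤n , x∈

MM-ofDegree : ℕ → List Term
MM-ofDegree 1 = M · M ∷ []
MM-ofDegree _ = []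

-- The first argument is fuel: the list is correct for degrees below it and independent of it there.
stableOfDegree : ℕ → ℕ → List Term
stableOfDegree zero    _       = []
stableOfDegree (suc f) zero    = M ∷ []
stableOfDegree (suc f) (suc d) =
  MM-ofDegree (suc d) ++ productsUpTo (positive (stableOfDegree f)) (stableOfDegree f) d d

stableOfDegree-sound : ∀ f d {t} → t ∈ stableOfDegree f d → Stable t × degree t ≡ d
stableOfDegree-sound (suc f) zero    (here refl) = M , refl
stableOfDegree-sound (suc f) (suc d) t∈ with ∈-++⁻ (MM-ofDegree (suc d)) t∈
stableOfDegree-sound (suc f) 1       _  | inj₁ (here refl) = MM , refl
... | inj₂ t∈′
  with i , x , y , i≤d , x∈ , y∈ , refl ← ∈-productsUpTo⁻ d t∈′
  with 0<i , x∈′ ← ∈-positive⁻ i x∈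
  with sx , dx ← stableOfDegree-sound f i x∈′
     | sy , dy ← stableOfDegree-sound f (d ∸ i) y∈
  = Stable-· sx (subst (0 <_) (sym dx) 0<i) sy
  , cong suc (trans (cong₂ ℕ._+_ dx dy) (ℕ.m+[n∸m]≡n i≤d))

stableOfDegree-complete : ∀ f {t} → Stable t → degree t < f → t ∈ stableOfDegree f (degree t)
stableOfDegree-complete (suc f) M  _ = here refl
stableOfDegree-complete (suc f) MM _ =
  ∈-++⁺ˡ {ys = productsUpTo (positive (stableOfDegree f)) (stableOfDegree f) 0 0} (here refl)
stableOfDegree-complete (suc f) (_·_ {a} {b} {c} sab sc) (s≤s deg<f) =
  ∈-++⁺ʳ (MM-ofDegree (suc n))
    (∈-productsUpTo⁺ (ℕ.m≤m+n dx dc)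
      (stableOfDegree-complete f sab (ℕ.≤-<-trans (ℕ.m≤m+n dx dc) deg<f))
      (subst (λ j → c ∈ stableOfDegree f j) (sym (ℕ.m+n∸m≡n dx dc))
        (stableOfDegree-complete f sc (ℕ.≤-<-trans (ℕ.m≤n+m dc dx) deg<f))))
  where
  dx dc n : ℕ
  dx = degree (a · b)
  dc = degree c
  n  = dx ℕ.+ dc

MM-ofDegree-unique : ∀ d → Unique (MM-ofDegree d)
MM-ofDegree-unique 0             = []
MM-ofDegree-unique 1             = [] ∷ []
MM-ofDegree-unique (suc (suc d)) = []

MM-ofDegree-disjoint : ∀ {A B} d {t} →
                       ¬ (t ∈ MM-ofDegree (suc d) × t ∈ productsUpTo (positive A) B d d)
MM-ofDegree-disjoint {A} {B} zero (here refl , t∈) with ∈-productsUpTo⁻ {positive A} {B} {0} 0 t∈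
... | .0 , _ , _ , z≤n , () , _

stableOfDegree-unique : ∀ f d → Unique (stableOfDegree f d)
stableOfDegree-unique zero    _       = []
stableOfDegree-unique (suc f) zero    = [] ∷ []
stableOfDegree-unique (suc f) (suc d) =
  Unique.++⁺ (MM-ofDegree-unique (suc d))
             (productsUpTo-unique positive-unique (stableOfDegree-unique f) positive-degree d)
             (MM-ofDegree-disjoint d)
  where
  positive-unique : ∀ i → Unique (positive (stableOfDegree f) i)
  positive-unique zero    = []
  positive-unique (suc i) = stableOfDegree-unique f (suc i)
  positive-degree : ∀ {i x} → x ∈ positive (stableOfDegree f) i → degree x ≡ i
  positive-degree {i} x∈ = proj₂ (stableOfDegree-sound f i (proj₂ (∈-positive⁻ i x∈)))

stableOfDegree-fuel : ∀ f g d → d < f → d < g → stableOfDegree f d ≡ stableOfDegree g d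
stableOfDegree-fuel (suc f) (suc g) zero    _         _         = refl
stableOfDegree-fuel (suc f) (suc g) (suc d) (s≤s d<f) (s≤s d<g) =
  cong (MM-ofDegree (suc d) ++_) (productsUpTo-cong d d positive-fuel fuel)
  where
  fuel : ∀ j → j ≤ d → stableOfDegree f j ≡ stableOfDegree g j
  fuel j j≤d = stableOfDegree-fuel f g j (ℕ.≤-<-trans j≤d d<f) (ℕ.≤-<-trans j≤d d<g)
  positive-fuel : ∀ i → i ≤ d → positive (stableOfDegree f) i ≡ positive (stableOfDegree g) i
  positive-fuel zero    _   = refl
  positive-fuel (suc i) i≤d = fuel (suc i) i≤d

sumUpTo-cong : ∀ n {f g : ℕ → ℤ} → (∀ i → i ≤ n → f i ≡ g i) → sumUpTo n f ≡ sumUpTo n g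
sumUpTo-cong zero    f≗g = f≗g 0 z≤n
sumUpTo-cong (suc n) f≗g =
  cong₂ _+_ (sumUpTo-cong n (λ i i≤n → f≗g i (ℕ.m≤n⇒m≤1+n i≤n))) (f≗g (suc n) ℕ.≤-refl)

sumUpTo-suc : ∀ n (f : ℕ → ℤ) → sumUpTo (suc n) f ≡ f 0 + sumUpTo n (λ i → f (suc i))
sumUpTo-suc zero    f = refl
sumUpTo-suc (suc n) f = trans (cong (_+ f (suc (suc n))) (sumUpTo-suc n f)) (ℤ.+-assoc (f 0) _ _)

sumUpTo-difference : ∀ n (f g : ℕ → ℤ) → sumUpTo n (λ i → f i - g i) ≡ sumUpTo n f - sumUpTo n g
sumUpTo-difference zero    f g = refl
sumUpTo-difference (suc n) f g =
  trans (cong (_+ (f (suc n) - g (suc n))) (sumUpTo-difference n f g))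
        (interchange (sumUpTo n f) (sumUpTo n g) (f (suc n)) (g (suc n)))
  where
  interchange : ∀ a b c d → (a - b) + (c - d) ≡ (a + c) - (b + d)
  interchange = solve-∀

sumUpTo-zero : ∀ n {f : ℕ → ℤ} → (∀ i → f i ≡ + 0) → sumUpTo n f ≡ + 0
sumUpTo-zero zero    f≗0 = f≗0 0
sumUpTo-zero (suc n) f≗0 = cong₂ _+_ (sumUpTo-zero n f≗0) (f≗0 (suc n))

*ₛ-identityˡ : ∀ G → 1ₛ *ₛ G ≈ₛ G
*ₛ-identityˡ G zero    = ℤ.*-identityˡ (G 0)
*ₛ-identityˡ G (suc n) = begin
  (1ₛ *ₛ G) (suc n)
    ≡⟨ sumUpTo-suc n _ ⟩
  + 1 * G (suc n) + sumUpTo n (λ i → + 0 * G (n ∸ i))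
    ≡⟨ cong₂ _+_ (ℤ.*-identityˡ (G (suc n))) (sumUpTo-zero n (λ i → ℤ.*-zeroˡ (G (n ∸ i)))) ⟩
  G (suc n) + + 0
    ≡⟨ ℤ.+-identityʳ _ ⟩
  G (suc n)
    ∎
  where open ≡-Reasoning

zₛ-suc : ∀ i → zₛ (suc i) ≡ 1ₛ i
zₛ-suc zero    = refl
zₛ-suc (suc i) = refl

zₛ*ₛ-suc : ∀ G n → (zₛ *ₛ G) (suc n) ≡ G n
zₛ*ₛ-suc G n = begin
  (zₛ *ₛ G) (suc n)
    ≡⟨ sumUpTo-suc n _ ⟩
  + 0 * G (suc n) + sumUpTo n (λ i → zₛ (suc i) * G (n ∸ i))
    ≡⟨ cong₂ _+_ (ℤ.*-zeroˡ (G (suc n)))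
                 (sumUpTo-cong n (λ i _ → cong (_* G (n ∸ i)) (zₛ-suc i))) ⟩
  + 0 + (1ₛ *ₛ G) n
    ≡⟨ ℤ.+-identityˡ _ ⟩
  (1ₛ *ₛ G) n
    ≡⟨ *ₛ-identityˡ G n ⟩
  G n
    ∎
  where open ≡-Reasoning

zₛ*ₛ*ₛ-suc : ∀ G H n → (zₛ *ₛ G *ₛ H) (suc n) ≡ (G *ₛ H) n
zₛ*ₛ*ₛ-suc G H n = begin
  (zₛ *ₛ G *ₛ H) (suc n)
    ≡⟨ sumUpTo-suc n _ ⟩
  (zₛ *ₛ G) 0 * H (suc n) + sumUpTo n (λ i → (zₛ *ₛ G) (suc i) * H (n ∸ i))
    ≡⟨ cong₂ _+_ (ℤ.*-zeroˡ (H (suc n)))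
                 (sumUpTo-cong n (λ i _ → cong (_* H (n ∸ i)) (zₛ*ₛ-suc G i))) ⟩
  + 0 + (G *ₛ H) n
    ≡⟨ ℤ.+-identityˡ _ ⟩
  (G *ₛ H) n
    ∎
  where open ≡-Reasoning

*ₛ-distribʳ-difference : ∀ F G H → (F -ₛ G) *ₛ H ≈ₛ F *ₛ H -ₛ G *ₛ H
*ₛ-distribʳ-difference F G H n = begin
  ((F -ₛ G) *ₛ H) n
    ≡⟨ sumUpTo-cong n (λ i _ → distrib (F i) (G i) (H (n ∸ i))) ⟩
  sumUpTo n (λ i → F i * H (n ∸ i) - G i * H (n ∸ i))
    ≡⟨ sumUpTo-difference n _ _ ⟩
  (F *ₛ H -ₛ G *ₛ H) n
    ∎
  where
  open ≡-Reasoning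
  distrib : ∀ a b c → (a - b) * c ≡ a * c - b * c
  distrib = solve-∀

stables : ℕ → List Term
stables d = stableOfDegree (suc d) d

stables⇔MaxComb : ∀ d t → (t ∈ stables d) ⇔ MaxComb d t
stables⇔MaxComb d t = mk⇔
  (λ t∈ → Equivalence.from (MaxComb⇔Stable d t) (stableOfDegree-sound (suc d) d t∈))
  (λ max → complete (Equivalence.to (MaxComb⇔Stable d t) max))
  where
  complete : Stable t × degree t ≡ d → t ∈ stables d
  complete (st , refl) = stableOfDegree-complete (suc (degree t)) st ℕ.≤-refl

maxCount : ℕ → ℕ
maxCount d = length (stables d)

Fmax : Series
Fmax d = + maxCount d

length-MM-ofDegree : ∀ n → + length (MM-ofDegree n) ≡ zₛ n
length-MM-ofDegree 0             = refl
length-MM-ofDegree 1             = refl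
length-MM-ofDegree (suc (suc n)) = refl

length-stableOfDegree : ∀ d j → j ≤ d → length (stableOfDegree (suc d) j) ≡ maxCount j
length-stableOfDegree d j j≤d =
  cong length (stableOfDegree-fuel (suc d) (suc j) j (s≤s j≤d) ℕ.≤-refl)

length-positive-stableOfDegree : ∀ d i → i ≤ d →
                                 + length (positive (stableOfDegree (suc d)) i) ≡ (Fmax -ₛ 1ₛ) i
length-positive-stableOfDegree d zero    _   = refl
length-positive-stableOfDegree d (suc i) i≤d =
  trans (cong +_ (length-stableOfDegree d (suc i) i≤d)) (sym (ℤ.+-identityʳ (Fmax (suc i))))

Fmax-suc : ∀ d → Fmax (suc d) ≡ zₛ (suc d) + ((Fmax -ₛ 1ₛ) *ₛ Fmax) d
Fmax-suc d = begin
  + length (MM-ofDegree (suc d) ++ P)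
    ≡⟨ cong +_ (List.length-++ (MM-ofDegree (suc d))) ⟩
  + (length (MM-ofDegree (suc d)) ℕ.+ length P)
    ≡⟨ ℤ.pos-+ (length (MM-ofDegree (suc d))) (length P) ⟩
  + length (MM-ofDegree (suc d)) + + length P
    ≡⟨ cong₂ _+_ (length-MM-ofDegree (suc d)) (length-productsUpTo d) ⟩
  zₛ (suc d) + sumUpTo d (λ i → + length (A i) * + length (B (d ∸ i)))
    ≡⟨ cong (λ x → zₛ (suc d) + x) (sumUpTo-cong d (λ i i≤d →
         cong₂ _*_ (length-positive-stableOfDegree d i i≤d)
                   (cong +_ (length-stableOfDegree d (d ∸ i) (ℕ.m∸n≤m d i))))) ⟩
  zₛ (suc d) + ((Fmax -ₛ 1ₛ) *ₛ Fmax) d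
    ∎
  where
  open ≡-Reasoning
  A B : ℕ → List Term
  A = positive (stableOfDegree (suc d))
  B = stableOfDegree (suc d)
  P : List Term
  P = productsUpTo A B d d

Fmax-equation : Fmax ≈ₛ 1ₛ +ₛ zₛ +ₛ zₛ *ₛ Fmax *ₛ Fmax -ₛ zₛ *ₛ Fmax
Fmax-equation zero    = refl
Fmax-equation (suc d) = begin
  Fmax (suc d)
    ≡⟨ Fmax-suc d ⟩
  zₛ (suc d) + ((Fmax -ₛ 1ₛ) *ₛ Fmax) d
    ≡⟨ cong (λ x → zₛ (suc d) + x) (*ₛ-distribʳ-difference Fmax 1ₛ Fmax d) ⟩
  zₛ (suc d) + ((Fmax *ₛ Fmax) d - (1ₛ *ₛ Fmax) d)
    ≡⟨ cong (λ x → zₛ (suc d) + ((Fmax *ₛ Fmax) d - x)) (*ₛ-identityˡ Fmax d) ⟩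
  zₛ (suc d) + ((Fmax *ₛ Fmax) d - Fmax d)
    ≡⟨ ℤ.+-assoc (zₛ (suc d)) _ _ ⟨
  zₛ (suc d) + (Fmax *ₛ Fmax) d - Fmax d
    ≡⟨ cong₂ _-_ (cong₂ _+_ (ℤ.+-identityˡ (zₛ (suc d))) (zₛ*ₛ*ₛ-suc Fmax Fmax d))
                 (zₛ*ₛ-suc Fmax d) ⟨
  (1ₛ +ₛ zₛ +ₛ zₛ *ₛ Fmax *ₛ Fmax -ₛ zₛ *ₛ Fmax) (suc d)
    ∎
  where open ≡-Reasoning

mainTheorem10 : Σ (ℕ → ℕ) (λ m
    → (∀ d → Σ (List Term) (λ L → Unique L × (∀ t → (t ∈ L) ⇔ MaxComb d t) × length L ≡ m d))
    × (let F = λ d → + (m d) in F ≈ₛ 1ₛ +ₛ zₛ +ₛ zₛ *ₛ F *ₛ F -ₛ zₛ *ₛ F))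
mainTheorem10 =
    maxCount
  , (λ d → stables d , stableOfDegree-unique (suc d) d , stables⇔MaxComb d , refl)
  , Fmax-equation
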